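{- Let $A$ be a set of $2n$ positive integers. Then $d_n(A)\le \frac12\binom{2n}{n}+h$, where $h$ is the number of abundant strong separations of $A$.
   Context: For a finite set $A$ of positive integers, write $\sum A$ for the sum of its elements. A subset $B\subseteq A$ is a divisor of $A$ if $\sum B$ divides $\sum A$; $d_n(A)$ is the number of $n$-element subsets of $A$ that are divisors of $A$. A separation of $A$ is an unordered pair $\{B,C\}$ of disjoint subsets of $A$ with $B\cup C=A$; it is strong if $|B|=|C|$, and abundant if both $B$ and $C$ are divisors of $A$. -}

module Defs where

open import Data.Nat using (ℕ; zero; suc; _+_; _*_; _<_; _/_)
open import Data.Nat.Divisibility using (_∣_; _∣?_)
open import Data.Bool using (Bool; true; false; if_then_else_)
open import Data.Fin using (Fin)
open import Data.Fin.Subset using (Subset; _∈_; ∁; ∣_∣)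
open import Data.Vec using (Vec; []; _∷_)
open import Data.List using (List; []; _∷_; map; _++_; length; filter)
open import Data.Product using (_×_)
open import Relation.Binary.PropositionalEquality using (_≡_)
open import Data.Product.Properties using ()
open import Relation.Nullary using (Dec; yes; no)
open import Relation.Nullary.Decidable using (_×-dec_)
open import Data.Nat using (_≟_)
open import Data.Vec.Properties using (≡-dec)
import Data.Bool.Properties as BP

_≟ᵛ_ : ∀ {m} (B C : Subset m) → Dec (B ≡ C)
_≟ᵛ_ = ≡-dec BP._≟_

-- A finite set A of 2n (or m) positive integers is given as an injective
-- labelling  a : Fin m → ℕ  with all values positive.
-- Subsets B ⊆ A correspond to subsets of the index set Fin m.

sumOver : ∀ {m} → (Fin m → ℕ) → Subset m → ℕ
sumOver {zero}  a []           = 0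
sumOver {suc m} a (true  ∷ bs) = a Fin.zero + sumOver (λ i → a (Fin.suc i)) bs
sumOver {suc m} a (false ∷ bs) = sumOver (λ i → a (Fin.suc i)) bs

total : ∀ {m} → (Fin m → ℕ) → ℕ
total {m} a = sumOver a (Data.Fin.Subset.⊤)

IsDivisor : ∀ {m} → (Fin m → ℕ) → Subset m → Set
IsDivisor a B = sumOver a B ∣ total a

isDivisor? : ∀ {m} (a : Fin m → ℕ) (B : Subset m) → Dec (IsDivisor a B)
isDivisor? a B = sumOver a B ∣? total a

allSubsets : ∀ m → List (Subset m)
allSubsets zero    = [] ∷ []
allSubsets (suc m) = map (true ∷_) (allSubsets m) ++ map (false ∷_) (allSubsets m)

dₙ : ∀ {m} → ℕ → (Fin m → ℕ) → ℕ
dₙ {m} n a = length (filter (λ B → (∣ B ∣ ≟ n) ×-dec isDivisor? a B) (allSubsets m))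

-- Ordered count: subsets B with |B| = |∁B| such that both B and ∁B are divisors.
-- Each strong separation {B, C} (C = ∁B) is counted exactly twice (as B and as C).
orderedAbundantStrong : ∀ {m} → (Fin m → ℕ) → ℕ
orderedAbundantStrong {m} a =
  length (filter (λ B → ((∣ B ∣ ≟ ∣ ∁ B ∣) ×-dec isDivisor? a B) ×-dec isDivisor? a (∁ B))
                 (allSubsets m))

-- Self-complementary ones (B = ∁B, only possible when m = 0) are counted once.
selfComplAbundantStrong : ∀ {m} → (Fin m → ℕ) → ℕ
selfComplAbundantStrong {m} a =
  length (filter (λ B → ((B ≟ᵛ ∁ B) ×-dec isDivisor? a B) ×-dec isDivisor? a (∁ B))
                 (allSubsets m))

-- h: number of abundant strong separations (unordered pairs {B, ∁B}):
-- each pair with B ≠ ∁B is counted twice in the ordered count, each with B = ∁B once.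
abundantStrongSeparations : ∀ {m} → (Fin m → ℕ) → ℕ
abundantStrongSeparations a = (orderedAbundantStrong a + selfComplAbundantStrong a) / 2

-- Pair every subset B of A with its complement ∁B. When |A| = 2n, B has n
-- elements exactly when ∁B does, so the C(2n,n) subsets of size n split into
-- complementary pairs. Such a pair contributes at most one divisor to d_n(A)
-- unless both halves are divisors, i.e. unless {B, ∁B} is an abundant strong
-- separation; summing over the pairs gives 2 d_n(A) ≤ C(2n,n) + 2h.
module Submission where

open import Defs
open import Data.Nat using (ℕ; _+_; _*_; _<_; _≤_)
open import Data.Nat.Combinatorics using (_C_)
open import Data.Fin using (Fin)
open import Function.Definitions using (Injective)
open import Relation.Binary.PropositionalEquality using (_≡_)

open import Data.Nat using (zero; suc; _∸_; z≤n; s≤s; _/_; _≟_)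
open import Data.Nat.Properties
open import Algebra.Properties.CommutativeSemigroup +-commutativeSemigroup
  using () renaming (interchange to +-interchange)
open import Data.Nat.DivMod using (m*n/n≡m; /-monoˡ-≤)
open import Data.Nat.Combinatorics using (nCk+nC[k+1]≡[n+1]C[k+1])
open import Data.Bool using (Bool; true; false; _∧_; not)
open import Data.Bool.Properties using (not-involutive; ∧-assoc; ∧-comm)
open import Data.List using (List; []; _∷_; map; _++_; length; filter)
open import Data.Vec using () renaming (_∷_ to _∷ᵛ_)
import Data.Vec.Properties as Vec
open import Data.Fin.Subset using (Subset; ∁; ∣_∣)
open import Data.Fin.Subset.Properties using (∣∁p∣≡n∸∣p∣)
open import Function using (_∘_)
open import Relation.Nullary using (does; yes; no; _×-dec_)
open import Relation.Nullary.Decidable using (dec-true; dec-false; does-⇔)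
open import Function.Bundles using (mk⇔)
open import Relation.Unary using (Pred; Decidable)
open import Relation.Binary.PropositionalEquality
  using (refl; sym; trans; cong; cong₂; _≗_; module ≡-Reasoning)

private
  variable
    X Y : Set

𝟙 : Bool → ℕ
𝟙 true  = 1
𝟙 false = 0

𝟙-+≤1+𝟙-∧ : ∀ x y → 𝟙 x + 𝟙 y ≤ 1 + 𝟙 (x ∧ y)
𝟙-+≤1+𝟙-∧ true  y     = ≤-refl
𝟙-+≤1+𝟙-∧ false true  = ≤-refl
𝟙-+≤1+𝟙-∧ false false = z≤n

∑ : List X → (X → ℕ) → ℕ
∑ []       g = 0
∑ (x ∷ xs) g = g x + ∑ xs g

length-filter≡∑ : ∀ {p} {P : Pred X p} (P? : Decidable P) xs →
                  length (filter P? xs) ≡ ∑ xs (𝟙 ∘ does ∘ P?)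
length-filter≡∑ P? []       = refl
length-filter≡∑ P? (x ∷ xs) with does (P? x)
... | true  = cong suc (length-filter≡∑ P? xs)
... | false = length-filter≡∑ P? xs

∑-zero : ∀ (xs : List X) → ∑ xs (λ _ → 0) ≡ 0
∑-zero []       = refl
∑-zero (x ∷ xs) = ∑-zero xs

∑-++ : ∀ (xs ys : List X) g → ∑ (xs ++ ys) g ≡ ∑ xs g + ∑ ys g
∑-++ []       ys g = refl
∑-++ (x ∷ xs) ys g = trans (cong (g x +_) (∑-++ xs ys g)) (sym (+-assoc (g x) _ _))

∑-map : ∀ (h : X → Y) xs g → ∑ (map h xs) g ≡ ∑ xs (g ∘ h)
∑-map h []       g = refl
∑-map h (x ∷ xs) g = cong (g (h x) +_) (∑-map h xs g)

∑-cong : ∀ (xs : List X) {g h} → g ≗ h → ∑ xs g ≡ ∑ xs h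
∑-cong []       g≗h = refl
∑-cong (x ∷ xs) g≗h = cong₂ _+_ (g≗h x) (∑-cong xs g≗h)

∑-mono-≤ : ∀ (xs : List X) {g h} → (∀ x → g x ≤ h x) → ∑ xs g ≤ ∑ xs h
∑-mono-≤ []       g≤h = z≤n
∑-mono-≤ (x ∷ xs) g≤h = +-mono-≤ (g≤h x) (∑-mono-≤ xs g≤h)

∑-distrib-+ : ∀ (xs : List X) g h → ∑ xs (λ x → g x + h x) ≡ ∑ xs g + ∑ xs h
∑-distrib-+ []       g h = refl
∑-distrib-+ (x ∷ xs) g h =
  trans (cong (g x + h x +_) (∑-distrib-+ xs g h)) (+-interchange (g x) (h x) (∑ xs g) (∑ xs h))

∑-allSubsets-suc : ∀ m (g : Subset (suc m) → ℕ) →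
                   ∑ (allSubsets (suc m)) g ≡
                   ∑ (allSubsets m) (g ∘ (true ∷ᵛ_)) + ∑ (allSubsets m) (g ∘ (false ∷ᵛ_))
∑-allSubsets-suc m g = trans (∑-++ (map (true ∷ᵛ_) (allSubsets m)) _ g)
  (cong₂ _+_ (∑-map (true ∷ᵛ_) (allSubsets m) g) (∑-map (false ∷ᵛ_) (allSubsets m) g))

∑-allSubsets-∁ : ∀ m (g : Subset m → ℕ) → ∑ (allSubsets m) (g ∘ ∁) ≡ ∑ (allSubsets m) g
∑-allSubsets-∁ zero    g = refl
∑-allSubsets-∁ (suc m) g = begin
  ∑ (allSubsets (suc m)) (g ∘ ∁)          ≡⟨ ∑-allSubsets-suc m (g ∘ ∁) ⟩
  ∑ S (g ∘ (false ∷ᵛ_) ∘ ∁) + ∑ S (g ∘ (true ∷ᵛ_) ∘ ∁)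
    ≡⟨ cong₂ _+_ (∑-allSubsets-∁ m (g ∘ (false ∷ᵛ_))) (∑-allSubsets-∁ m (g ∘ (true ∷ᵛ_))) ⟩
  ∑ S (g ∘ (false ∷ᵛ_)) + ∑ S (g ∘ (true ∷ᵛ_)) ≡⟨ +-comm (∑ S (g ∘ (false ∷ᵛ_))) _ ⟩
  ∑ S (g ∘ (true ∷ᵛ_)) + ∑ S (g ∘ (false ∷ᵛ_)) ≡⟨ ∑-allSubsets-suc m g ⟨
  ∑ (allSubsets (suc m)) g                ∎
  where
  open ≡-Reasoning
  S = allSubsets m

-- For m ≥ 1, complementation pairs the subsets containing the first element
-- with those avoiding it, so a complement-invariant sum is twice a half-sum.
∑-allSubsets-∁-invariant : ∀ m (g : Subset (suc m) → ℕ) → g ∘ ∁ ≗ g →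
                           ∑ (allSubsets (suc m)) g ≡ 2 * ∑ (allSubsets m) (g ∘ (true ∷ᵛ_))
∑-allSubsets-∁-invariant m g g∘∁≗g = begin
  ∑ (allSubsets (suc m)) g       ≡⟨ ∑-allSubsets-suc m g ⟩
  half + ∑ S (g ∘ (false ∷ᵛ_))   ≡⟨ cong (half +_) (∑-allSubsets-∁ m (g ∘ (false ∷ᵛ_))) ⟨
  half + ∑ S (g ∘ ∁ ∘ (true ∷ᵛ_)) ≡⟨ cong (half +_) (∑-cong S (g∘∁≗g ∘ (true ∷ᵛ_))) ⟩
  half + half                    ≡⟨ cong (half +_) (+-identityʳ half) ⟨
  2 * half                       ∎
  where
  open ≡-Reasoning
  S = allSubsets m
  half = ∑ S (g ∘ (true ∷ᵛ_))

-- Pascal's rule: ∣ true ∷ B ∣ computes to suc ∣ B ∣, so the subsets containing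
-- the first element contribute the (k-1)-subsets of the rest.
∑-allSubsets-size≡C : ∀ m k → ∑ (allSubsets m) (λ B → 𝟙 (does (∣ B ∣ ≟ k))) ≡ m C k
∑-allSubsets-size≡C zero    zero    = refl
∑-allSubsets-size≡C zero    (suc k) = refl
∑-allSubsets-size≡C (suc m) zero    = trans (∑-allSubsets-suc m _)
  (cong₂ _+_ (∑-zero (allSubsets m)) (∑-allSubsets-size≡C m zero))
∑-allSubsets-size≡C (suc m) (suc k) = trans (∑-allSubsets-suc m _)
  (trans (cong₂ _+_ (∑-allSubsets-size≡C m k) (∑-allSubsets-size≡C m (suc k)))
         (nCk+nC[k+1]≡[n+1]C[k+1] m k))

∁-involutive : ∀ {m} (p : Subset m) → ∁ (∁ p) ≡ p
∁-involutive p = trans (sym (Vec.map-∘ not not p))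
                       (trans (Vec.map-cong not-involutive p) (Vec.map-id p))

∣p∣≡n⇒∣∁p∣≡n : ∀ {n} (p : Subset (2 * n)) → ∣ p ∣ ≡ n → ∣ ∁ p ∣ ≡ n
∣p∣≡n⇒∣∁p∣≡n {n} p ∣p∣≡n = begin
  ∣ ∁ p ∣         ≡⟨ ∣∁p∣≡n∸∣p∣ p ⟩
  2 * n ∸ ∣ p ∣   ≡⟨ cong (2 * n ∸_) ∣p∣≡n ⟩
  n + (n + 0) ∸ n ≡⟨ cong (λ k → n + k ∸ n) (+-identityʳ n) ⟩
  n + n ∸ n       ≡⟨ m+n∸m≡n n n ⟩
  n               ∎
  where open ≡-Reasoning

∣∁p∣≡n⇒∣p∣≡n : ∀ {n} (p : Subset (2 * n)) → ∣ ∁ p ∣ ≡ n → ∣ p ∣ ≡ n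
∣∁p∣≡n⇒∣p∣≡n p ∣∁p∣≡n = trans (cong ∣_∣ (sym (∁-involutive p))) (∣p∣≡n⇒∣∁p∣≡n (∁ p) ∣∁p∣≡n)

m≤[2*m+k]/2 : ∀ m k → m ≤ (2 * m + k) / 2
m≤[2*m+k]/2 m k = begin
  m             ≡⟨ m*n/n≡m m 2 ⟨
  m * 2 / 2     ≡⟨ cong (_/ 2) (*-comm m 2) ⟩
  2 * m / 2     ≤⟨ /-monoˡ-≤ 2 (m≤m+n (2 * m) k) ⟩
  (2 * m + k) / 2 ∎
  where open ≤-Reasoning

module _ {m} (a : Fin m → ℕ) where

  isAbundantStrong : Subset m → Bool
  isAbundantStrong B =
    does (((∣ B ∣ ≟ ∣ ∁ B ∣) ×-dec isDivisor? a B) ×-dec isDivisor? a (∁ B))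

  isAbundantStrong-∁ : isAbundantStrong ∘ ∁ ≗ isAbundantStrong
  isAbundantStrong-∁ B = begin
    (does (∣ ∁ B ∣ ≟ ∣ ∁ (∁ B) ∣) ∧ div∁B) ∧ does (isDivisor? a (∁ (∁ B)))
      ≡⟨ cong (λ C → (does (∣ ∁ B ∣ ≟ ∣ C ∣) ∧ div∁B) ∧ does (isDivisor? a C)) (∁-involutive B) ⟩
    (does (∣ ∁ B ∣ ≟ ∣ B ∣) ∧ div∁B) ∧ divB
      ≡⟨ cong (λ s → (s ∧ div∁B) ∧ divB) (does-⇔ (mk⇔ sym sym) (∣ ∁ B ∣ ≟ ∣ B ∣) (∣ B ∣ ≟ ∣ ∁ B ∣)) ⟩
    (size ∧ div∁B) ∧ divB ≡⟨ ∧-assoc size div∁B divB ⟩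
    size ∧ (div∁B ∧ divB) ≡⟨ cong (size ∧_) (∧-comm div∁B divB) ⟩
    size ∧ (divB ∧ div∁B) ≡⟨ ∧-assoc size divB div∁B ⟨
    (size ∧ divB) ∧ div∁B ∎
    where
    open ≡-Reasoning
    size  = does (∣ B ∣ ≟ ∣ ∁ B ∣)
    divB  = does (isDivisor? a B)
    div∁B = does (isDivisor? a (∁ B))

-- The zero clause is the one place a subset is its own complement (the empty
-- set), which is why h counts such separations separately.
orderedAbundantStrong≤2*abundantStrongSeparations : ∀ {m} (a : Fin m → ℕ) →
  orderedAbundantStrong a ≤ 2 * abundantStrongSeparations a
orderedAbundantStrong≤2*abundantStrongSeparations {zero}  a = s≤s z≤n
orderedAbundantStrong≤2*abundantStrongSeparations {suc m} a = begin
  orderedAbundantStrong a      ≡⟨ ordered≡2*half ⟩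
  2 * half                     ≤⟨ *-monoʳ-≤ 2 (m≤[2*m+k]/2 half (selfComplAbundantStrong a)) ⟩
  2 * ((2 * half + selfComplAbundantStrong a) / 2)
    ≡⟨ cong (λ t → 2 * ((t + selfComplAbundantStrong a) / 2)) ordered≡2*half ⟨
  2 * abundantStrongSeparations a ∎
  where
  open ≤-Reasoning
  half = ∑ (allSubsets m) (𝟙 ∘ isAbundantStrong a ∘ (true ∷ᵛ_))
  ordered≡2*half : orderedAbundantStrong a ≡ 2 * half
  ordered≡2*half = trans (length-filter≡∑ _ (allSubsets (suc m)))
    (∑-allSubsets-∁-invariant m (𝟙 ∘ isAbundantStrong a) (cong 𝟙 ∘ isAbundantStrong-∁ a))

module _ (n : ℕ) (a : Fin (2 * n) → ℕ) where

  complementary-pair-bound : ∀ (B : Subset (2 * n)) →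
    𝟙 (does (∣ B ∣ ≟ n) ∧ does (isDivisor? a B)) + 𝟙 (does (∣ ∁ B ∣ ≟ n) ∧ does (isDivisor? a (∁ B)))
      ≤ 𝟙 (does (∣ B ∣ ≟ n)) + 𝟙 (isAbundantStrong a B)
  -- The with only supplies the proof: the goal holds does (∣ B ∣ ≟ n) in
  -- normal form, so it is rewritten explicitly like the other two tests.
  complementary-pair-bound B with ∣ B ∣ ≟ n
  ... | yes ∣B∣≡n
    rewrite dec-true (∣ B ∣ ≟ n) ∣B∣≡n
          | dec-true (∣ ∁ B ∣ ≟ n) (∣p∣≡n⇒∣∁p∣≡n B ∣B∣≡n)
          | dec-true (∣ B ∣ ≟ ∣ ∁ B ∣) (trans ∣B∣≡n (sym (∣p∣≡n⇒∣∁p∣≡n B ∣B∣≡n)))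
    = 𝟙-+≤1+𝟙-∧ (does (isDivisor? a B)) (does (isDivisor? a (∁ B)))
  ... | no ∣B∣≢n
    rewrite dec-false (∣ B ∣ ≟ n) ∣B∣≢n
          | dec-false (∣ ∁ B ∣ ≟ n) (∣B∣≢n ∘ ∣∁p∣≡n⇒∣p∣≡n B)
    = z≤n

  2*dₙ≤C+orderedAbundantStrong : 2 * dₙ n a ≤ (2 * n) C n + orderedAbundantStrong a
  2*dₙ≤C+orderedAbundantStrong = begin
    2 * dₙ n a                            ≡⟨ cong (2 *_) (length-filter≡∑ _ S) ⟩
    ∑ S d + (∑ S d + 0)                   ≡⟨ cong (∑ S d +_) (trans (+-identityʳ _) (sym (∑-allSubsets-∁ _ d))) ⟩
    ∑ S d + ∑ S (d ∘ ∁)                   ≡⟨ ∑-distrib-+ S d (d ∘ ∁) ⟨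
    ∑ S (λ B → d B + d (∁ B))             ≤⟨ ∑-mono-≤ S complementary-pair-bound ⟩
    ∑ S (λ B → size B + abundant B)       ≡⟨ ∑-distrib-+ S size abundant ⟩
    ∑ S size + ∑ S abundant               ≡⟨ cong₂ _+_ (∑-allSubsets-size≡C (2 * n) n) (sym (length-filter≡∑ _ S)) ⟩
    (2 * n) C n + orderedAbundantStrong a ∎
    where
    open ≤-Reasoning
    S = allSubsets (2 * n)
    d size abundant : Subset (2 * n) → ℕ
    d B        = 𝟙 (does (∣ B ∣ ≟ n) ∧ does (isDivisor? a B))
    size B     = 𝟙 (does (∣ B ∣ ≟ n))
    abundant B = 𝟙 (isAbundantStrong a B)

mainTheorem9 : (n : ℕ) (a : Fin (2 * n) → ℕ) →
    Injective _≡_ _≡_ a →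
    (∀ i → 0 < a i) →
    2 * dₙ n a ≤ (2 * n) C n + 2 * abundantStrongSeparations a
mainTheorem9 n a _ _ = ≤-trans (2*dₙ≤C+orderedAbundantStrong n a)
  (+-monoʳ-≤ ((2 * n) C n) (orderedAbundantStrong≤2*abundantStrongSeparations a))
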